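{- Let $A=\{a_1,\ldots,a_d\}$ with $d\ge0$ and $a_1<\cdots<a_d$ positive integers, and let $t^p(A)=\sum_{1\leq i_1<i_2<\cdots<i_p\leq d}z^p\prod_{j=1}^p x^{a_{i_j}}$ (so $t^p(A)=0$ for $p>d$). Then $$D^A=\frac{1+\sum_{p=2}^d\sum_{j=0}^{p-2}\binom{p-2}{j}t^{p+j}(A)(y-1)^{p-1}}{1-t^1(A)-\sum_{p=3}^d\sum_{j=0}^{p-3}\binom{p-3}{j}t^{p+j}(A)(y-1)^{p-2}}.$$
   Context: A composition with parts in $A$ is a finite sequence $\sigma=\sigma_1\cdots\sigma_m$ ($m\ge 0$, the empty sequence included) of elements of $A$; $n(\sigma)=\sigma_1+\cdots+\sigma_m$ and $m(\sigma)=m$. For a sequence $w=w_1\cdots w_\ell$ of integers, an occurrence of the pattern $123$ in $w$ is an index $i$, $1\le i\le \ell-2$, with $w_i<w_{i+1}<w_{i+2}$. Let $a$ be any integer smaller than every element of $A$ (e.g. $a=0$), and let $r(\sigma)$ denote the number of occurrences of $123$ in the sequence $a\sigma_1\cdots\sigma_m$ (this does not depend on the choice of $a$). Then $D^A=D^A(x,y,z)=\sum_\sigma x^{n(\sigma)}y^{r(\sigma)}z^{m(\sigma)}$, summing over all compositions $\sigma$ with parts in $A$. -}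

module Defs where

open import Data.Nat as ℕ using (ℕ; zero; suc; _∸_; _<ᵇ_; _≡ᵇ_)
open import Data.Nat.Combinatorics using (_C_)
open import Data.Integer as ℤ using (ℤ; +_; -[1+_])
open import Data.List using (List; []; _∷_; map; concatMap; upTo; length)
open import Data.Nat.ListAction using (sum)
open import Data.Bool using (Bool; true; false; if_then_else_; _∧_)
open import Relation.Binary.PropositionalEquality using (_≡_)

-- Formal power series in x, y, z with integer coefficients:
-- F n r m is the coefficient of x^n y^r z^m.

Series : Set
Series = ℕ → ℕ → ℕ → ℤ

infix 4 _≈S_
_≈S_ : Series → Series → Set
F ≈S G = ∀ n r m → F n r m ≡ G n r m

sumTo : ℕ → (ℕ → ℤ) → ℤ
sumTo zero    f = f 0
sumTo (suc n) f = sumTo n f ℤ.+ f (suc n)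

infixl 6 _⊕_
infixl 7 _⊗_

_⊕_ : Series → Series → Series
(F ⊕ G) n r m = F n r m ℤ.+ G n r m

_⊗_ : Series → Series → Series
(F ⊗ G) n r m =
  sumTo n λ a → sumTo r λ b → sumTo m λ c →
    F a b c ℤ.* G (n ∸ a) (r ∸ b) (m ∸ c)

⊖_ : Series → Series
(⊖ F) n r m = ℤ.- F n r m

cst : ℤ → Series
cst k zero zero zero = k
cst k _    _    _    = + 0

𝟘 𝟙 : Series
𝟘 = cst (+ 0)
𝟙 = cst (+ 1)

X Y Z : Series
X (suc zero) zero zero = + 1
X _ _ _ = + 0
Y zero (suc zero) zero = + 1
Y _ _ _ = + 0
Z zero zero (suc zero) = + 1
Z _ _ _ = + 0

_^S_ : Series → ℕ → Series
F ^S zero  = 𝟙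
F ^S suc k = F ⊗ (F ^S k)

-- [lo .. hi] (empty if hi < lo)
range : ℕ → ℕ → List ℕ
range lo hi = map (lo ℕ.+_) (upTo (suc hi ∸ lo))

ΣS : List ℕ → (ℕ → Series) → Series
ΣS []       F = 𝟘
ΣS (p ∷ ps) F = F p ⊕ ΣS ps F

-- elementary symmetric polynomial e_p(x^{a_1}, …, x^{a_d})
esym : ℕ → List ℕ → Series
esym zero    _       = 𝟙
esym (suc p) []      = 𝟘
esym (suc p) (a ∷ A) = esym (suc p) A ⊕ (X ^S a) ⊗ esym p A

t : ℕ → List ℕ → Series
t p A = (Z ^S p) ⊗ esym p A

words : List ℕ → ℕ → List (List ℕ)
words A zero    = [] ∷ []
words A (suc m) = concatMap (λ a → map (a ∷_) (words A m)) A

occ123 : List ℕ → ℕ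
occ123 (a ∷ b ∷ c ∷ w) =
  (if (a <ᵇ b) ∧ (b <ᵇ c) then 1 else 0) ℕ.+ occ123 (b ∷ c ∷ w)
occ123 _ = 0

-- r(σ): occurrences of 123 in 0σ (0 is smaller than every element of A)
rr : List ℕ → ℕ
rr σ = occ123 (0 ∷ σ)

countᵇ : {X : Set} → (X → Bool) → List X → ℕ
countᵇ P []       = 0
countᵇ P (x ∷ xs) = (if P x then 1 else 0) ℕ.+ countᵇ P xs

-- coefficient of x^n y^r z^m in D^A: number of compositions with parts
-- in A, with m parts, sum n and r occurrences of 123
D : List ℕ → Series
D A n r m = + countᵇ (λ σ → (sum σ ≡ᵇ n) ∧ (rr σ ≡ᵇ r)) (words A m)

binS : ℕ → ℕ → Series
binS n k = cst (+ (n C k))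

y-1 : Series
y-1 = Y ⊕ cst -[1+ 0 ]

Num : List ℕ → Series
Num A = 𝟙 ⊕ ΣS (range 2 d) λ p → ΣS (range 0 (p ∸ 2)) λ j →
          binS (p ∸ 2) j ⊗ t (p ℕ.+ j) A ⊗ (y-1 ^S (p ∸ 1))
  where d = length A

Den : List ℕ → Series
Den A = 𝟙 ⊕ ⊖ t 1 A ⊕ ⊖ (ΣS (range 3 d) λ p → ΣS (range 0 (p ∸ 3)) λ j →
          binS (p ∸ 3) j ⊗ t (p ℕ.+ j) A ⊗ (y-1 ^S (p ∸ 2)))
  where d = length A

-- Let u = y - 1, let w be given by w 0 = -1, w 1 = 1, w (k+2) = u (w (k+1) + w k), and write
-- t^k for t^k(A). Pascal's rule gives w (m+3) = Σ_q C(q, m-q) u^(q+1), so regrouping the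
-- double sums of the statement along antidiagonals yields Den = - Σ_k w k t^k and
-- Num = Σ_k w (k+1) t^k.
--
-- Let C(b,ε) be the series of the words σ over A weighted by the occurrences of 123 in c b σ,
-- where ε records whether c < b. Splitting off the first letter gives
-- C(b,ε) = 1 + Σ_a x^a z y^[b<a ∧ ε] C(a, b<a), and D^A = C(0,false). With W = Σ_k w k t^k and
-- P(b,ε) = Σ_k f_ε k t^k(A_{>b}), where f_false k = w (k+1) and f_true k = w (k+2) + w (k+1),
-- the recursion t^(k+1)(a ∷ A) = t^(k+1)(A) + x^a z t^k(A) and f_ε (k+1) + w (k+1) = y^[ε] f_true k
-- show that P + W satisfies the same system without the constant 1. Hence C W + P satisfies a
-- homogeneous system in which every term raises the z-degree, so it vanishes, and
-- D^A Den = - C(0,false) W = P(0,false) = Num.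

module Submission where

open import Defs
open import Data.Nat as ℕ using (ℕ; zero; suc; _∸_; _≤_; _<_; z≤n; s≤s; _≤ᵇ_; _<ᵇ_; _≡ᵇ_)
import Data.Nat.Properties as ℕP
open import Data.Nat.Combinatorics using (_C_; k>n⇒nCk≡0; nCk+nC[k+1]≡[n+1]C[k+1])
open import Data.Nat.ListAction using (sum)
open import Data.Integer as ℤ using (ℤ; +_; -[1+_])
open import Data.Integer.Properties as ℤP using (+-*-commutativeRing)
open import Data.Bool using (Bool; true; false; if_then_else_; _∧_; T)
open import Data.Bool.Properties using (∧-commutativeMonoid; ∧-comm; ∧-zeroʳ)
open import Data.List using (List; []; _∷_; map; concatMap; _++_; applyUpTo; length; filterᵇ)
open import Data.List.Properties using (filter-all; filter-reject)
open import Data.List.Relation.Unary.All as All using (All; []; _∷_)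
open import Data.List.Relation.Unary.AllPairs using (AllPairs; _∷_)
open import Data.List.Relation.Unary.Linked using (Linked)
open import Data.List.Relation.Unary.Linked.Properties using (Linked⇒AllPairs)
open import Data.Product using (_×_; _,_; proj₁; proj₂)
open import Data.Sum using (inj₁; inj₂)
open import Function using (_∘_)
open import Algebra.Bundles using (CommutativeRing; CommutativeMonoid; Semiring)
open import Algebra.Structures using (IsCommutativeRing)
open import Relation.Nullary.Decidable using (T?)
open import Relation.Binary.PropositionalEquality as ≡ using (_≡_)
import Relation.Binary.Reasoning.Setoid as ≈-Reasoning
import Algebra.Properties.CommutativeSemigroup as CommSemigroupProperties
import Algebra.Definitions.RawSemiring as RawSemiringDefinitions

module Sums {c ℓ} (R : CommutativeRing c ℓ) where
  open CommutativeRing R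
  open ≈-Reasoning setoid
  open CommSemigroupProperties +-commutativeSemigroup using (interchange)

  Σ< : ℕ → (ℕ → Carrier) → Carrier
  Σ< zero    f = 0#
  Σ< (suc n) f = f 0 + Σ< n (λ i → f (suc i))

  Σ<-cong : ∀ n {f g} → (∀ i → f i ≈ g i) → Σ< n f ≈ Σ< n g
  Σ<-cong zero    f≈g = refl
  Σ<-cong (suc n) f≈g = +-cong (f≈g 0) (Σ<-cong n (λ i → f≈g (suc i)))

  Σ<-cong-< : ∀ n {f g} → (∀ i → i < n → f i ≈ g i) → Σ< n f ≈ Σ< n g
  Σ<-cong-< zero    f≈g = refl
  Σ<-cong-< (suc n) f≈g =
    +-cong (f≈g 0 (s≤s z≤n)) (Σ<-cong-< n (λ i i<n → f≈g (suc i) (s≤s i<n)))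

  Σ<-zero : ∀ n {f} → (∀ i → f i ≈ 0#) → Σ< n f ≈ 0#
  Σ<-zero zero    f≈0 = refl
  Σ<-zero (suc n) f≈0 = trans (+-cong (f≈0 0) (Σ<-zero n (λ i → f≈0 (suc i)))) (+-identityˡ 0#)

  Σ<-suc : ∀ n f → Σ< (suc n) f ≈ Σ< n f + f n
  Σ<-suc zero    f = trans (+-identityʳ _) (sym (+-identityˡ _))
  Σ<-suc (suc n) f = trans (+-congˡ (Σ<-suc n (λ i → f (suc i)))) (sym (+-assoc _ _ _))

  Σ<-+ : ∀ n f g → Σ< n (λ i → f i + g i) ≈ Σ< n f + Σ< n g
  Σ<-+ zero    f g = sym (+-identityˡ 0#)
  Σ<-+ (suc n) f g =
    trans (+-congˡ (Σ<-+ n (λ i → f (suc i)) (λ i → g (suc i)))) (interchange _ _ _ _)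

  Σ<-*ˡ : ∀ n x f → x * Σ< n f ≈ Σ< n (λ i → x * f i)
  Σ<-*ˡ zero    x f = zeroʳ x
  Σ<-*ˡ (suc n) x f = trans (distribˡ x _ _) (+-congˡ (Σ<-*ˡ n x (λ i → f (suc i))))

  Σ<-*ʳ : ∀ n x f → Σ< n f * x ≈ Σ< n (λ i → f i * x)
  Σ<-*ʳ n x f = trans (*-comm _ x) (trans (Σ<-*ˡ n x f) (Σ<-cong n (λ i → *-comm x (f i))))

  Σ<-truncate : ∀ k n f → k ≤ n → (∀ j → k ≤ j → f j ≈ 0#) → Σ< n f ≈ Σ< k f
  Σ<-truncate zero    n       f _         f≈0 = Σ<-zero n (λ j → f≈0 j z≤n)
  Σ<-truncate (suc k) (suc n) f (s≤s k≤n) f≈0 =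
    +-congˡ (Σ<-truncate k n (λ i → f (suc i)) k≤n (λ j k≤j → f≈0 (suc j) (s≤s k≤j)))

  Σ<-reverse : ∀ n f → Σ< n f ≈ Σ< n (λ i → f (n ∸ suc i))
  Σ<-reverse zero    f = refl
  Σ<-reverse (suc n) f = begin
    Σ< (suc n) f                            ≈⟨ Σ<-suc n f ⟩
    Σ< n f + f n                            ≈⟨ +-congʳ (Σ<-reverse n f) ⟩
    Σ< n (λ i → f (n ∸ suc i)) + f n        ≈⟨ +-comm _ _ ⟩
    f n + Σ< n (λ i → f (n ∸ suc i))        ∎

  Σ<-antidiagonal : ∀ L (G : ℕ → ℕ → Carrier) →
    Σ< L (λ q → Σ< (L ∸ q) (G q)) ≈ Σ< L (λ m → Σ< (suc m) (λ q → G q (m ∸ q)))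
  Σ<-antidiagonal zero    G = refl
  Σ<-antidiagonal (suc L) G = begin
    Σ< (suc L) (G 0) + Σ< L (λ q → Σ< (L ∸ q) (G (suc q)))
      ≈⟨ +-congˡ (Σ<-antidiagonal L (λ q → G (suc q))) ⟩
    Σ< (suc L) (G 0) + Σ< L (λ m → Σ< (suc m) (λ q → G (suc q) (m ∸ q)))
      ≈⟨ +-congˡ (sym (+-identityˡ _)) ⟩
    Σ< (suc L) (G 0) + (0# + Σ< L (λ m → Σ< (suc m) (λ q → G (suc q) (m ∸ q))))
      ≈⟨ Σ<-+ (suc L) (G 0) (λ m → Σ< m (λ q → G (suc q) (m ∸ suc q))) ⟨
    Σ< (suc L) (λ m → Σ< (suc m) (λ q → G q (m ∸ q)))  ∎

  Σ<-triangle : ∀ L (F : ℕ → ℕ → Carrier) →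
    (∀ q j → q < j → F q j ≈ 0#) → (∀ q j → L ≤ q ℕ.+ j → F q j ≈ 0#) →
    Σ< L (λ q → Σ< (suc q) (F q)) ≈ Σ< L (λ m → Σ< (suc m) (λ q → F q (m ∸ q)))
  Σ<-triangle L F above-diagonal beyond-L =
    trans (Σ<-cong L row) (Σ<-antidiagonal L F)
    where
    row : ∀ q → Σ< (suc q) (F q) ≈ Σ< (L ∸ q) (F q)
    row q with ℕP.≤-total (suc q) (L ∸ q)
    ... | inj₁ q<L∸q = sym (Σ<-truncate (suc q) (L ∸ q) (F q) q<L∸q (above-diagonal q))
    ... | inj₂ L∸q≤q = Σ<-truncate (L ∸ q) (suc q) (F q) L∸q≤q
          (λ j L∸q≤j → beyond-L q j (ℕP.≤-trans (ℕP.m≤n+m∸n L q) (ℕP.+-monoʳ-≤ q L∸q≤j)))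

module Convolution {c ℓ} (R : CommutativeRing c ℓ) where
  open CommutativeRing R
  open ≈-Reasoning setoid
  open Sums R

  Seq : Set c
  Seq = ℕ → Carrier

  infix  4 _≋_
  infixl 6 _⊞_
  infixl 7 _⊠_

  _≋_ : Seq → Seq → Set ℓ
  f ≋ g = ∀ i → f i ≈ g i

  _⊞_ : Seq → Seq → Seq
  (f ⊞ g) i = f i + g i

  ⊟_ : Seq → Seq
  (⊟ f) i = - f i

  𝟎 𝟏 : Seq
  𝟎 _       = 0#
  𝟏 zero    = 1#
  𝟏 (suc _) = 0#

  _⊠_ : Seq → Seq → Seq
  (f ⊠ g) n = Σ< (suc n) (λ a → f a * g (n ∸ a))

  tail : Seq → Seq
  tail f i = f (suc i)

  scale : Carrier → Seq → Seq
  scale x f i = x * f i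

  ⊠-cong : ∀ {f f′ g g′} → f ≋ f′ → g ≋ g′ → f ⊠ g ≋ f′ ⊠ g′
  ⊠-cong f≋f′ g≋g′ n = Σ<-cong (suc n) (λ a → *-cong (f≋f′ a) (g≋g′ (n ∸ a)))

  ⊠-comm : ∀ f g → f ⊠ g ≋ g ⊠ f
  ⊠-comm f g n = begin
    Σ< (suc n) (λ a → f a * g (n ∸ a))                ≈⟨ Σ<-reverse (suc n) (λ a → f a * g (n ∸ a)) ⟩
    Σ< (suc n) (λ a → f (n ∸ a) * g (n ∸ (n ∸ a)))    ≈⟨ Σ<-cong-< (suc n) swap ⟩
    Σ< (suc n) (λ a → g a * f (n ∸ a))                ∎
    where
    swap : ∀ a → a < suc n → f (n ∸ a) * g (n ∸ (n ∸ a)) ≈ g a * f (n ∸ a)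
    swap a (s≤s a≤n) = trans (*-comm _ _) (*-congʳ (reflexive (≡.cong g (ℕP.m∸[m∸n]≡n a≤n))))

  ⊠-distribʳ : ∀ h f g → (f ⊞ g) ⊠ h ≋ f ⊠ h ⊞ g ⊠ h
  ⊠-distribʳ h f g n = trans (Σ<-cong (suc n) (λ a → distribʳ (h (n ∸ a)) (f a) (g a)))
                             (Σ<-+ (suc n) (λ a → f a * h (n ∸ a)) (λ a → g a * h (n ∸ a)))

  ⊠-distribˡ : ∀ h f g → h ⊠ (f ⊞ g) ≋ h ⊠ f ⊞ h ⊠ g
  ⊠-distribˡ h f g n = begin
    (h ⊠ (f ⊞ g)) n        ≈⟨ ⊠-comm h (f ⊞ g) n ⟩
    ((f ⊞ g) ⊠ h) n        ≈⟨ ⊠-distribʳ h f g n ⟩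
    (f ⊠ h) n + (g ⊠ h) n  ≈⟨ +-cong (⊠-comm f h n) (⊠-comm g h n) ⟩
    (h ⊠ f) n + (h ⊠ g) n  ∎

  ⊠-identityˡ : ∀ f → 𝟏 ⊠ f ≋ f
  ⊠-identityˡ f zero    = trans (+-identityʳ _) (*-identityˡ _)
  ⊠-identityˡ f (suc n) = begin
    1# * f (suc n) + Σ< (suc n) (λ a → 0# * f (n ∸ a))
      ≈⟨ +-cong (*-identityˡ _) (Σ<-zero (suc n) (λ a → zeroˡ (f (n ∸ a)))) ⟩
    f (suc n) + 0#
      ≈⟨ +-identityʳ _ ⟩
    f (suc n) ∎

  ⊠-identityʳ : ∀ f → f ⊠ 𝟏 ≋ f
  ⊠-identityʳ f n = trans (⊠-comm f 𝟏 n) (⊠-identityˡ f n)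

  scale-⊠ : ∀ x f h → scale x f ⊠ h ≋ scale x (f ⊠ h)
  scale-⊠ x f h n = trans (Σ<-cong (suc n) (λ a → *-assoc x (f a) (h (n ∸ a))))
                          (sym (Σ<-*ˡ (suc n) x (λ a → f a * h (n ∸ a))))

  -- (f ⊠ g) (suc n) unfolds to f 0 * g (suc n) + (tail f ⊠ g) n, so tail (f ⊠ g) is
  -- definitionally scale (f 0) (tail g) ⊞ tail f ⊠ g and the induction is on n.
  ⊠-assoc : ∀ f g h → (f ⊠ g) ⊠ h ≋ f ⊠ (g ⊠ h)
  ⊠-assoc f g h zero    =
    +-congʳ (trans (*-congʳ (+-identityʳ _)) (trans (*-assoc _ _ _) (*-congˡ (sym (+-identityʳ _)))))
  ⊠-assoc f g h (suc n) = begin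
    (f ⊠ g) 0 * h (suc n) + ((scale (f 0) (tail g) ⊞ tail f ⊠ g) ⊠ h) n
      ≈⟨ +-cong (*-congʳ (+-identityʳ _)) (⊠-distribʳ h (scale (f 0) (tail g)) (tail f ⊠ g) n) ⟩
    (f 0 * g 0) * h (suc n) + ((scale (f 0) (tail g) ⊠ h) n + ((tail f ⊠ g) ⊠ h) n)
      ≈⟨ +-congˡ (+-cong (scale-⊠ (f 0) (tail g) h n) (⊠-assoc (tail f) g h n)) ⟩
    (f 0 * g 0) * h (suc n) + (f 0 * (tail g ⊠ h) n + (tail f ⊠ (g ⊠ h)) n)
      ≈⟨ +-assoc _ _ _ ⟨
    ((f 0 * g 0) * h (suc n) + f 0 * (tail g ⊠ h) n) + (tail f ⊠ (g ⊠ h)) n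
      ≈⟨ +-congʳ (trans (+-congʳ (*-assoc _ _ _)) (sym (distribˡ _ _ _))) ⟩
    f 0 * (g ⊠ h) (suc n) + (tail f ⊠ (g ⊠ h)) n  ∎

  ⊠-isCommutativeRing : IsCommutativeRing _≋_ _⊞_ _⊠_ ⊟_ 𝟎 𝟏
  ⊠-isCommutativeRing = record
    { isRing = record
      { +-isAbelianGroup = record
        { isGroup = record
          { isMonoid = record
            { isSemigroup = record
              { isMagma = record
                { isEquivalence = record
                  { refl = λ _ → refl ; sym = λ e i → sym (e i) ; trans = λ e e′ i → trans (e i) (e′ i) }
                ; ∙-cong = λ e e′ i → +-cong (e i) (e′ i) }
              ; assoc = λ f g h i → +-assoc (f i) (g i) (h i) }
            ; identity = (λ f i → +-identityˡ (f i)) , (λ f i → +-identityʳ (f i)) }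
          ; inverse = (λ f i → -‿inverseˡ (f i)) , (λ f i → -‿inverseʳ (f i))
          ; ⁻¹-cong = λ e i → -‿cong (e i) }
        ; comm = λ f g i → +-comm (f i) (g i) }
      ; *-cong = ⊠-cong
      ; *-assoc = ⊠-assoc
      ; *-identity = ⊠-identityˡ , ⊠-identityʳ
      ; distrib = ⊠-distribˡ , ⊠-distribʳ }
    ; *-comm = ⊠-comm }

  convolutionRing : CommutativeRing c ℓ
  convolutionRing = record { isCommutativeRing = ⊠-isCommutativeRing }

  Σ<-apply : ∀ n (h : ℕ → Seq) i → Sums.Σ< convolutionRing n h i ≈ Σ< n (λ a → h a i)
  Σ<-apply zero    h i = refl
  Σ<-apply (suc n) h i = +-congˡ (Σ<-apply n (λ a → h (suc a)) i)

module _ {c ℓ} (R : CommutativeRing c ℓ) where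
  open CommutativeRing R

  isCommutativeRing-≈-operations :
    ∀ {_+′_ _*′_ : Carrier → Carrier → Carrier} {neg : Carrier → Carrier} {0′ 1′ : Carrier} →
    (∀ x y → x +′ y ≈ x + y) → (∀ x y → x *′ y ≈ x * y) → (∀ x → neg x ≈ - x) →
    0′ ≈ 0# → 1′ ≈ 1# → IsCommutativeRing _≈_ _+′_ _*′_ neg 0′ 1′
  isCommutativeRing-≈-operations {_+′_} {_*′_} {neg} {0′} {1′} +≈ *≈ -≈ 0≈ 1≈ = record
    { isRing = record
      { +-isAbelianGroup = record
        { isGroup = record
          { isMonoid = record
            { isSemigroup = record
              { isMagma = record { isEquivalence = isEquivalence ; ∙-cong = +′-cong }
              ; assoc = λ x y z → meet (trans (+≈ (x +′ y) z) (trans (+-congʳ (+≈ x y)) (+-assoc x y z)))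
                                       (trans (+≈ x (y +′ z)) (+-congˡ (+≈ y z))) }
            ; identity = (λ x → trans (+≈ 0′ x) (trans (+-congʳ 0≈) (+-identityˡ x)))
                       , (λ x → trans (+≈ x 0′) (trans (+-congˡ 0≈) (+-identityʳ x))) }
          ; inverse = (λ x → trans (+≈ (neg x) x) (trans (+-congʳ (-≈ x)) (trans (-‿inverseˡ x) (sym 0≈))))
                    , (λ x → trans (+≈ x (neg x)) (trans (+-congˡ (-≈ x)) (trans (-‿inverseʳ x) (sym 0≈))))
          ; ⁻¹-cong = λ {x} {y} x≈y → trans (-≈ x) (trans (-‿cong x≈y) (sym (-≈ y))) }
        ; comm = λ x y → trans (+≈ x y) (trans (+-comm x y) (sym (+≈ y x))) }
      ; *-cong = *′-cong
      ; *-assoc = λ x y z → meet (trans (*≈ (x *′ y) z) (trans (*-congʳ (*≈ x y)) (*-assoc x y z)))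
                                 (trans (*≈ x (y *′ z)) (*-congˡ (*≈ y z)))
      ; *-identity = (λ x → trans (*≈ 1′ x) (trans (*-congʳ 1≈) (*-identityˡ x)))
                   , (λ x → trans (*≈ x 1′) (trans (*-congˡ 1≈) (*-identityʳ x)))
      ; distrib = (λ x y z → trans (*≈ x (y +′ z)) (trans (*-congˡ (+≈ y z))
                               (trans (distribˡ x y z) (sym (trans (+≈ _ _) (+-cong (*≈ x y) (*≈ x z)))))))
                , (λ x y z → trans (*≈ (y +′ z) x) (trans (*-congʳ (+≈ y z))
                               (trans (distribʳ x y z) (sym (trans (+≈ _ _) (+-cong (*≈ y x) (*≈ z x))))))) }
    ; *-comm = λ x y → trans (*≈ x y) (trans (*-comm x y) (sym (*≈ y x))) }
    where
    +′-cong : ∀ {x x′ y y′} → x ≈ x′ → y ≈ y′ → x +′ y ≈ x′ +′ y′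
    +′-cong {x} {x′} {y} {y′} x≈ y≈ = trans (+≈ x y) (trans (+-cong x≈ y≈) (sym (+≈ x′ y′)))
    *′-cong : ∀ {x x′ y y′} → x ≈ x′ → y ≈ y′ → x *′ y ≈ x′ *′ y′
    *′-cong {x} {x′} {y} {y′} x≈ y≈ = trans (*≈ x y) (trans (*-cong x≈ y≈) (sym (*≈ x′ y′)))
    meet : ∀ {x y w} → x ≈ w → y ≈ w → x ≈ y
    meet x≈w y≈w = trans x≈w (sym y≈w)

-- Series n r m is read as an element of ((ℤ[[z]])[[y]])[[x]].
module SeriesRing where

  ℤ[[z]] ℤ[[y,z]] ℤ[[x,y,z]] : CommutativeRing _ _
  ℤ[[z]]     = Convolution.convolutionRing +-*-commutativeRing
  ℤ[[y,z]]   = Convolution.convolutionRing ℤ[[z]]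
  ℤ[[x,y,z]] = Convolution.convolutionRing ℤ[[y,z]]

  open Sums +-*-commutativeRing using (Σ<; Σ<-suc)

  sumTo≡Σ< : ∀ n f → sumTo n f ≡ Σ< (suc n) f
  sumTo≡Σ< zero    f = ≡.sym (ℤP.+-identityʳ (f 0))
  sumTo≡Σ< (suc n) f = ≡.trans (≡.cong (ℤ._+ f (suc n)) (sumTo≡Σ< n f)) (≡.sym (Σ<-suc (suc n) f))

  Σ<-cong : ∀ n {f g : ℕ → ℤ} → (∀ i → f i ≡ g i) → Σ< n f ≡ Σ< n g
  Σ<-cong = Sums.Σ<-cong +-*-commutativeRing

  ⊗-as-Σ< : ∀ F G n r m → (F ⊗ G) n r m ≡
    Σ< (suc n) (λ a → Σ< (suc r) (λ b → Σ< (suc m) (λ c → F a b c ℤ.* G (n ∸ a) (r ∸ b) (m ∸ c))))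
  ⊗-as-Σ< F G n r m =
    ≡.trans (sumTo≡Σ< n (λ a → sumTo r (λ b → sumTo m (summand a b)))) (Σ<-cong (suc n) (λ a →
      ≡.trans (sumTo≡Σ< r (λ b → sumTo m (summand a b))) (Σ<-cong (suc r) (λ b → sumTo≡Σ< m (summand a b)))))
    where
    summand : ℕ → ℕ → ℕ → ℤ
    summand a b c = F a b c ℤ.* G (n ∸ a) (r ∸ b) (m ∸ c)

  ⊗≈* : ∀ F G → F ⊗ G ≈S CommutativeRing._*_ ℤ[[x,y,z]] F G
  ⊗≈* F G n r m = begin
    (F ⊗ G) n r m
      ≡⟨ ⊗-as-Σ< F G n r m ⟩
    Σ< (suc n) (λ a → Σ< (suc r) (λ b → (F a b ⊠₁ G (n ∸ a) (r ∸ b)) m))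
      ≡⟨ Σ<-cong (suc n) (λ a → ≡.sym (Σ<-apply₁ (suc r) (λ b → F a b ⊠₁ G (n ∸ a) (r ∸ b)) m)) ⟩
    Σ< (suc n) (λ a → (F a ⊠₂ G (n ∸ a)) r m)
      ≡⟨ ≡.sym (Σ<-apply₁ (suc n) (λ a → (F a ⊠₂ G (n ∸ a)) r) m) ⟩
    Sums.Σ< ℤ[[z]] (suc n) (λ a → (F a ⊠₂ G (n ∸ a)) r) m
      ≡⟨ ≡.sym (Σ<-apply₂ (suc n) (λ a → F a ⊠₂ G (n ∸ a)) r m) ⟩
    CommutativeRing._*_ ℤ[[x,y,z]] F G n r m ∎
    where
    open ≡.≡-Reasoning
    open Convolution +-*-commutativeRing using () renaming (_⊠_ to _⊠₁_; Σ<-apply to Σ<-apply₁)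
    open Convolution ℤ[[z]] using () renaming (_⊠_ to _⊠₂_; Σ<-apply to Σ<-apply₂)

  𝟘≈0# : 𝟘 ≈S CommutativeRing.0# ℤ[[x,y,z]]
  𝟘≈0# zero    zero    zero    = ≡.refl
  𝟘≈0# zero    zero    (suc m) = ≡.refl
  𝟘≈0# zero    (suc r) m       = ≡.refl
  𝟘≈0# (suc n) r       m       = ≡.refl

  𝟙≈1# : 𝟙 ≈S CommutativeRing.1# ℤ[[x,y,z]]
  𝟙≈1# zero    zero    zero    = ≡.refl
  𝟙≈1# zero    zero    (suc m) = ≡.refl
  𝟙≈1# zero    (suc r) m       = ≡.refl
  𝟙≈1# (suc n) r       m       = ≡.refl

  seriesRing : CommutativeRing _ _
  seriesRing = record
    { Carrier = Series ; _≈_ = _≈S_ ; _+_ = _⊕_ ; _*_ = _⊗_ ; -_ = ⊖_ ; 0# = 𝟘 ; 1# = 𝟙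
    ; isCommutativeRing = isCommutativeRing-≈-operations ℤ[[x,y,z]]
        (λ _ _ _ _ _ → ≡.refl) ⊗≈* (λ _ _ _ _ → ≡.refl) 𝟘≈0# 𝟙≈1# }

module Monomials where

  open SeriesRing using (seriesRing; ⊗-as-Σ<)
  open Sums +-*-commutativeRing using (Σ<; Σ<-cong; Σ<-zero)
  open CommutativeRing seriesRing using (*-cong; trans)

  when : Bool → ℤ → ℤ
  when p v = if p then v else + 0

  when-zero : ∀ p → when p (+ 0) ≡ + 0
  when-zero false = ≡.refl
  when-zero true  = ≡.refl

  when-∧ : ∀ p q v → when (p ∧ q) v ≡ when p (when q v)
  when-∧ false q v = ≡.refl
  when-∧ true  q v = ≡.refl

  Σ<-when : ∀ n p f → Σ< n (λ i → when p (f i)) ≡ when p (Σ< n f)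
  Σ<-when n false f = Σ<-zero n (λ _ → ≡.refl)
  Σ<-when n true  f = ≡.refl

  Σ<-point : ∀ n a f → Σ< n (λ i → when (a ≡ᵇ i) (f i)) ≡ when (a <ᵇ n) (f a)
  Σ<-point zero    a       f = ≡.refl
  Σ<-point (suc n) zero    f =
    ≡.trans (≡.cong (ℤ._+_ (f 0)) (Σ<-zero n (λ _ → ≡.refl))) (ℤP.+-identityʳ (f 0))
  Σ<-point (suc n) (suc a) f = ≡.trans (ℤP.+-identityˡ _) (Σ<-point n a (λ i → f (suc i)))

  <ᵇ-suc : ∀ a n → (a <ᵇ suc n) ≡ (a ≤ᵇ n)
  <ᵇ-suc zero    n = ≡.refl
  <ᵇ-suc (suc a) n = ≡.refl

  Σ<-point-≤ : ∀ n a f → Σ< (suc n) (λ i → when (a ≡ᵇ i) (f i)) ≡ when (a ≤ᵇ n) (f a)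
  Σ<-point-≤ n a f = ≡.trans (Σ<-point (suc n) a f) (≡.cong (λ p → when p (f a)) (<ᵇ-suc a n))

  +-≡ᵇ : ∀ a s n → (a ℕ.+ s ≡ᵇ n) ≡ (a ≤ᵇ n) ∧ (s ≡ᵇ n ∸ a)
  +-≡ᵇ zero    s n       = ≡.refl
  +-≡ᵇ (suc a) s zero    = ≡.refl
  +-≡ᵇ (suc a) s (suc n) =
    ≡.trans (+-≡ᵇ a s n) (≡.cong (_∧ (s ≡ᵇ n ∸ a)) (≡.sym (<ᵇ-suc a n)))

  mon : ℕ → ℕ → ℕ → Series
  mon a b c n r m = when (a ≡ᵇ n) (when (b ≡ᵇ r) (when (c ≡ᵇ m) (+ 1)))

  shift : ℕ → ℕ → ℕ → Series → Series
  shift a b c F n r m = when (a ≤ᵇ n) (when (b ≤ᵇ r) (when (c ≤ᵇ m) (F (n ∸ a) (r ∸ b) (m ∸ c))))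

  mon-coefficient-* : ∀ a b c i j l v →
    mon a b c i j l ℤ.* v ≡ when (a ≡ᵇ i) (when (b ≡ᵇ j) (when (c ≡ᵇ l) v))
  mon-coefficient-* a b c i j l v with a ≡ᵇ i | b ≡ᵇ j | c ≡ᵇ l
  ... | true  | true  | true  = ℤP.*-identityˡ v
  ... | true  | true  | false = ≡.refl
  ... | true  | false | _     = ≡.refl
  ... | false | _     | _     = ≡.refl

  mon-⊗ : ∀ a b c F → mon a b c ⊗ F ≈S shift a b c F
  mon-⊗ a b c F n r m = begin
    (mon a b c ⊗ F) n r m
      ≡⟨ ⊗-as-Σ< (mon a b c) F n r m ⟩
    Σ< (suc n) (λ i → Σ< (suc r) (λ j → Σ< (suc m) (λ l → mon a b c i j l ℤ.* F′ i j l)))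
      ≡⟨ Σ<-cong (suc n) (λ i → Σ<-cong (suc r) (λ j → Σ<-cong (suc m) (λ l →
           mon-coefficient-* a b c i j l (F′ i j l)))) ⟩
    Σ< (suc n) (λ i → Σ< (suc r) (λ j → Σ< (suc m) (λ l →
      when (a ≡ᵇ i) (when (b ≡ᵇ j) (when (c ≡ᵇ l) (F′ i j l))))))
      ≡⟨ Σ<-cong (suc n) (λ i → ≡.trans (Σ<-cong (suc r) (λ j →
           ≡.trans (Σ<-when (suc m) (a ≡ᵇ i) (λ l → when (b ≡ᵇ j) (G i j l)))
                   (≡.cong (when (a ≡ᵇ i)) (Σ<-when (suc m) (b ≡ᵇ j) (G i j)))))
           (Σ<-when (suc r) (a ≡ᵇ i) (λ j → when (b ≡ᵇ j) (Σ< (suc m) (G i j))))) ⟩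
    Σ< (suc n) (λ i → when (a ≡ᵇ i) (Σ< (suc r) (λ j → when (b ≡ᵇ j) (Σ< (suc m) (λ l →
      when (c ≡ᵇ l) (F′ i j l))))))
      ≡⟨ Σ<-point-≤ n a (λ i → Σ< (suc r) (λ j → when (b ≡ᵇ j) (Σ< (suc m) (G i j)))) ⟩
    when (a ≤ᵇ n) (Σ< (suc r) (λ j → when (b ≡ᵇ j) (Σ< (suc m) (λ l → when (c ≡ᵇ l) (F′ a j l)))))
      ≡⟨ ≡.cong (when (a ≤ᵇ n)) (≡.trans (Σ<-point-≤ r b (λ j → Σ< (suc m) (G a j)))
           (≡.cong (when (b ≤ᵇ r)) (Σ<-point-≤ m c (F′ a b)))) ⟩
    shift a b c F n r m ∎
    where
    open ≡.≡-Reasoning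
    F′ : ℕ → ℕ → ℕ → ℤ
    F′ i j l = F (n ∸ i) (r ∸ j) (m ∸ l)
    G : ℕ → ℕ → ℕ → ℤ
    G i j l = when (c ≡ᵇ l) (F′ i j l)

  shift-mon : ∀ a b c a′ b′ c′ → shift a b c (mon a′ b′ c′) ≈S mon (a ℕ.+ a′) (b ℕ.+ b′) (c ℕ.+ c′)
  shift-mon a b c a′ b′ c′ n r m
    rewrite +-≡ᵇ a a′ n | +-≡ᵇ b b′ r | +-≡ᵇ c c′ m
    with a ≤ᵇ n | b ≤ᵇ r | c ≤ᵇ m
  ... | false | _     | _     = ≡.refl
  ... | true  | false | _     = ≡.sym (when-zero (a′ ≡ᵇ n ∸ a))
  ... | true  | true  | false = ≡.sym (≡.trans (≡.cong (when (a′ ≡ᵇ n ∸ a)) (when-zero (b′ ≡ᵇ r ∸ b)))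
                                             (when-zero (a′ ≡ᵇ n ∸ a)))
  ... | true  | true  | true  = ≡.refl

  mon-⊗-mon : ∀ a b c a′ b′ c′ → mon a b c ⊗ mon a′ b′ c′ ≈S mon (a ℕ.+ a′) (b ℕ.+ b′) (c ℕ.+ c′)
  mon-⊗-mon a b c a′ b′ c′ = trans (mon-⊗ a b c (mon a′ b′ c′)) (shift-mon a b c a′ b′ c′)

  𝟙≈mon : 𝟙 ≈S mon 0 0 0
  𝟙≈mon zero    zero    zero    = ≡.refl
  𝟙≈mon zero    zero    (suc m) = ≡.refl
  𝟙≈mon zero    (suc r) m       = ≡.refl
  𝟙≈mon (suc n) r       m       = ≡.refl

  X≈mon : X ≈S mon 1 0 0
  X≈mon zero                r       m       = ≡.refl
  X≈mon (suc zero)          zero    zero    = ≡.refl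
  X≈mon (suc zero)          zero    (suc m) = ≡.refl
  X≈mon (suc zero)          (suc r) m       = ≡.refl
  X≈mon (suc (suc n))       r       m       = ≡.refl

  Y≈mon : Y ≈S mon 0 1 0
  Y≈mon (suc n) r                m       = ≡.refl
  Y≈mon zero    zero             m       = ≡.refl
  Y≈mon zero    (suc zero)       zero    = ≡.refl
  Y≈mon zero    (suc zero)       (suc m) = ≡.refl
  Y≈mon zero    (suc (suc r))    m       = ≡.refl

  Z≈mon : Z ≈S mon 0 0 1
  Z≈mon (suc n) r       m             = ≡.refl
  Z≈mon zero    (suc r) m             = ≡.refl
  Z≈mon zero    zero    zero          = ≡.refl
  Z≈mon zero    zero    (suc zero)    = ≡.refl
  Z≈mon zero    zero    (suc (suc m)) = ≡.refl

  X^≈mon : ∀ a → X ^S a ≈S mon a 0 0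
  X^≈mon zero    = 𝟙≈mon
  X^≈mon (suc a) = trans (*-cong X≈mon (X^≈mon a)) (mon-⊗-mon 1 0 0 a 0 0)

  ⟦_⟧ : Bool → ℕ
  ⟦ p ⟧ = if p then 1 else 0

  mon-cong : ∀ {a a′ b c} → a ≡ a′ → mon a b c ≈S mon a′ b c
  mon-cong ≡.refl _ _ _ = ≡.refl

  weight≈mon : ∀ a p {V} → V ≈S mon 0 ⟦ p ⟧ 0 → X ^S a ⊗ Z ⊗ V ≈S mon a ⟦ p ⟧ 1
  weight≈mon a p V≈ = trans (*-cong (trans (*-cong (X^≈mon a) Z≈mon) (mon-⊗-mon a 0 0 0 0 1)) V≈)
    (trans (mon-⊗-mon (a ℕ.+ 0) 0 1 0 ⟦ p ⟧ 0)
           (mon-cong {b = ⟦ p ⟧} {c = 1} (≡.trans (ℕP.+-identityʳ (a ℕ.+ 0)) (ℕP.+-identityʳ a))))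

  𝟘-coefficient : ∀ n r m → 𝟘 n r m ≡ + 0
  𝟘-coefficient zero    zero    zero    = ≡.refl
  𝟘-coefficient zero    zero    (suc m) = ≡.refl
  𝟘-coefficient zero    (suc r) m       = ≡.refl
  𝟘-coefficient (suc n) r       m       = ≡.refl

  𝟙-coefficient-suc : ∀ n r m → 𝟙 n r (suc m) ≡ + 0
  𝟙-coefficient-suc zero    zero    m = ≡.refl
  𝟙-coefficient-suc zero    (suc r) m = ≡.refl
  𝟙-coefficient-suc (suc n) r       m = ≡.refl

  ΣS-vanishing : ∀ L (F : ℕ → Series) n r m → (∀ a → F a n r m ≡ + 0) → ΣS L F n r m ≡ + 0
  ΣS-vanishing []      F n r m F≡0 = 𝟘-coefficient n r m
  ΣS-vanishing (a ∷ L) F n r m F≡0 = ≡.cong₂ ℤ._+_ (F≡0 a) (ΣS-vanishing L F n r m F≡0)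

  when²-zero : ∀ p q → when p (when q (+ 0)) ≡ + 0
  when²-zero p q = ≡.trans (≡.cong (when p) (when-zero q)) (when-zero p)

  mon-z-⊗-constant : ∀ a b F n r → (mon a b 1 ⊗ F) n r 0 ≡ + 0
  mon-z-⊗-constant a b F n r = ≡.trans (mon-⊗ a b 1 F n r 0) (when²-zero (a ≤ᵇ n) (b ≤ᵇ r))

  mon-z-⊗-suc : ∀ a b F n r m → (∀ n r → F n r m ≡ + 0) → (mon a b 1 ⊗ F) n r (suc m) ≡ + 0
  mon-z-⊗-suc a b F n r m F≡0 = ≡.trans (mon-⊗ a b 1 F n r (suc m))
    (≡.trans (≡.cong (λ v → when (a ≤ᵇ n) (when (b ≤ᵇ r) v)) (F≡0 (n ∸ a) (r ∸ b)))
             (when²-zero (a ≤ᵇ n) (b ≤ᵇ r)))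

  -- Every summand raises the z-degree, so by induction on it a solution vanishes.
  homogeneous-solution≈𝟘 : ∀ {I : Set} (L : List ℕ) (K : I → Series)
    (deg-y : I → ℕ → ℕ) (next : I → ℕ → I) →
    (∀ i → K i ≈S ΣS L (λ a → mon a (deg-y i a) 1 ⊗ K (next i a))) →
    ∀ i → K i ≈S 𝟘
  homogeneous-solution≈𝟘 L K deg-y next K-rec i n r m =
    ≡.trans (vanishes m i n r) (≡.sym (𝟘-coefficient n r m))
    where
    vanishes : ∀ m i n r → K i n r m ≡ + 0
    vanishes m i n r = ≡.trans (K-rec i n r m) (ΣS-vanishing L _ n r m (summand m))
      where
      summand : ∀ m a → (mon a (deg-y i a) 1 ⊗ K (next i a)) n r m ≡ + 0
      summand zero    a = mon-z-⊗-constant a (deg-y i a) (K (next i a)) n r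
      summand (suc m) a = mon-z-⊗-suc a (deg-y i a) (K (next i a)) n r m (vanishes m (next i a))


open Monomials

-- occ123-from b ε σ is the number of occurrences of 123 in c b σ, for any c with (c <ᵇ b) ≡ ε.
occ123-from : ℕ → Bool → List ℕ → ℕ
occ123-from b ε []      = 0
occ123-from b ε (a ∷ σ) = ⟦ (b <ᵇ a) ∧ ε ⟧ ℕ.+ occ123-from a (b <ᵇ a) σ

occ123≡occ123-from : ∀ c b σ → occ123 (c ∷ b ∷ σ) ≡ occ123-from b (c <ᵇ b) σ
occ123≡occ123-from c b []      = ≡.refl
occ123≡occ123-from c b (a ∷ σ) =
  ≡.cong₂ (λ p k → ⟦ p ⟧ ℕ.+ k) (∧-comm (c <ᵇ b) (b <ᵇ a)) (occ123≡occ123-from b a σ)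

rr≡occ123-from : ∀ σ → rr σ ≡ occ123-from 0 false σ
rr≡occ123-from []      = ≡.refl
rr≡occ123-from (a ∷ σ) = ≡.trans (occ123≡occ123-from 0 a σ)
  (≡.cong (λ p → ⟦ p ⟧ ℕ.+ occ123-from a (0 <ᵇ a) σ) (≡.sym (∧-zeroʳ (0 <ᵇ a))))

module _ {X : Set} where

  countᵇ-cong : ∀ {P Q : X → Bool} xs → (∀ x → P x ≡ Q x) → countᵇ P xs ≡ countᵇ Q xs
  countᵇ-cong []       P≡Q = ≡.refl
  countᵇ-cong (x ∷ xs) P≡Q = ≡.cong₂ (λ p k → ⟦ p ⟧ ℕ.+ k) (P≡Q x) (countᵇ-cong xs P≡Q)

  countᵇ-++ : ∀ P (xs ys : List X) → countᵇ P (xs ++ ys) ≡ countᵇ P xs ℕ.+ countᵇ P ys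
  countᵇ-++ P []       ys = ≡.refl
  countᵇ-++ P (x ∷ xs) ys =
    ≡.trans (≡.cong (⟦ P x ⟧ ℕ.+_) (countᵇ-++ P xs ys)) (≡.sym (ℕP.+-assoc ⟦ P x ⟧ _ _))

  countᵇ-map : ∀ {W : Set} P (f : W → X) ws → countᵇ P (map f ws) ≡ countᵇ (λ w → P (f w)) ws
  countᵇ-map P f []       = ≡.refl
  countᵇ-map P f (w ∷ ws) = ≡.cong (⟦ P (f w) ⟧ ℕ.+_) (countᵇ-map P f ws)

  countᵇ-guarded : ∀ p (P : X → Bool) xs → + countᵇ (λ x → p ∧ P x) xs ≡ when p (+ countᵇ P xs)
  countᵇ-guarded true  P xs = ≡.refl
  countᵇ-guarded false P []       = ≡.refl
  countᵇ-guarded false P (x ∷ xs) = countᵇ-guarded false P xs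

module Compositions (A : List ℕ) where

  open CommSemigroupProperties (CommutativeMonoid.commutativeSemigroup ∧-commutativeMonoid)
    using (interchange)

  C : ℕ → Bool → Series
  C b ε n r m = + countᵇ (λ σ → (sum σ ≡ᵇ n) ∧ (occ123-from b ε σ ≡ᵇ r)) (words A m)

  D≈C : D A ≈S C 0 false
  D≈C n r m = ≡.cong +_ (countᵇ-cong (words A m) (λ σ →
    ≡.cong (λ k → (sum σ ≡ᵇ n) ∧ (k ≡ᵇ r)) (rr≡occ123-from σ)))

  ascent : ℕ → Bool → ℕ → ℕ
  ascent b ε a = ⟦ (b <ᵇ a) ∧ ε ⟧

  count-prefixed : ∀ b ε a n r m →
    + countᵇ (λ σ → (sum σ ≡ᵇ n) ∧ (occ123-from b ε σ ≡ᵇ r)) (map (a ∷_) (words A m))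
      ≡ (mon a (ascent b ε a) 1 ⊗ C a (b <ᵇ a)) n r (suc m)
  count-prefixed b ε a n r m = begin
    + countᵇ (λ σ → (sum σ ≡ᵇ n) ∧ (occ123-from b ε σ ≡ᵇ r)) (map (a ∷_) (words A m))
      ≡⟨ ≡.cong +_ (≡.trans (countᵇ-map _ (a ∷_) (words A m)) (countᵇ-cong (words A m) guard-first)) ⟩
    + countᵇ (λ σ → ((a ≤ᵇ n) ∧ (d ≤ᵇ r)) ∧ ((sum σ ≡ᵇ n ∸ a) ∧ (o σ ≡ᵇ r ∸ d))) (words A m)
      ≡⟨ countᵇ-guarded ((a ≤ᵇ n) ∧ (d ≤ᵇ r)) (λ σ → (sum σ ≡ᵇ n ∸ a) ∧ (o σ ≡ᵇ r ∸ d)) (words A m) ⟩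
    when ((a ≤ᵇ n) ∧ (d ≤ᵇ r)) (C a (b <ᵇ a) (n ∸ a) (r ∸ d) m)
      ≡⟨ when-∧ (a ≤ᵇ n) (d ≤ᵇ r) _ ⟩
    shift a d 1 (C a (b <ᵇ a)) n r (suc m)
      ≡⟨ mon-⊗ a d 1 (C a (b <ᵇ a)) n r (suc m) ⟨
    (mon a d 1 ⊗ C a (b <ᵇ a)) n r (suc m) ∎
    where
    open ≡.≡-Reasoning
    d : ℕ
    d = ascent b ε a
    o : List ℕ → ℕ
    o = occ123-from a (b <ᵇ a)
    guard-first : ∀ σ → (a ℕ.+ sum σ ≡ᵇ n) ∧ (d ℕ.+ o σ ≡ᵇ r)
                      ≡ ((a ≤ᵇ n) ∧ (d ≤ᵇ r)) ∧ ((sum σ ≡ᵇ n ∸ a) ∧ (o σ ≡ᵇ r ∸ d))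
    guard-first σ rewrite +-≡ᵇ a (sum σ) n | +-≡ᵇ d (o σ) r =
      interchange (a ≤ᵇ n) (sum σ ≡ᵇ n ∸ a) (d ≤ᵇ r) (o σ ≡ᵇ r ∸ d)

  C-suc : ∀ b ε L n r m →
    + countᵇ (λ σ → (sum σ ≡ᵇ n) ∧ (occ123-from b ε σ ≡ᵇ r)) (concatMap (λ a → map (a ∷_) (words A m)) L)
      ≡ ΣS L (λ a → mon a (ascent b ε a) 1 ⊗ C a (b <ᵇ a)) n r (suc m)
  C-suc b ε []      n r m = ≡.sym (𝟘-coefficient n r (suc m))
  C-suc b ε (a ∷ L) n r m =
    ≡.trans (≡.cong +_ (countᵇ-++ P (map (a ∷_) (words A m)) (concatMap (λ a → map (a ∷_) (words A m)) L)))
   (≡.trans (ℤP.pos-+ (countᵇ P (map (a ∷_) (words A m))) _)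
            (≡.cong₂ ℤ._+_ (count-prefixed b ε a n r m) (C-suc b ε L n r m)))
    where
    P : List ℕ → Bool
    P σ = (sum σ ≡ᵇ n) ∧ (occ123-from b ε σ ≡ᵇ r)

  C-rec : ∀ b ε → C b ε ≈S 𝟙 ⊕ ΣS A (λ a → mon a (ascent b ε a) 1 ⊗ C a (b <ᵇ a))
  C-rec b ε n r zero = ≡.trans (empty-word n r) (≡.sym (≡.trans
    (≡.cong (ℤ._+_ (𝟙 n r 0)) (ΣS-vanishing A _ n r 0 (λ a →
      mon-z-⊗-constant a (ascent b ε a) (C a (b <ᵇ a)) n r)))
    (ℤP.+-identityʳ _)))
    where
    empty-word : ∀ n r → C b ε n r 0 ≡ 𝟙 n r 0
    empty-word zero    zero    = ≡.refl
    empty-word zero    (suc r) = ≡.refl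
    empty-word (suc n) r       = ≡.refl
  C-rec b ε n r (suc m) = ≡.trans (C-suc b ε A n r m) (≡.sym (≡.trans
    (≡.cong (ℤ._+ ΣS A _ n r (suc m)) (𝟙-coefficient-suc n r m)) (ℤP.+-identityˡ _)))

module _ {c ℓ} (R : CommutativeRing c ℓ) where
  open CommutativeRing R
  open ≈-Reasoning setoid
  open Sums R
  open RawSemiringDefinitions (Semiring.rawSemiring semiring) using (_^_)

  module Symmetric (e : ℕ → Carrier) where
    open CommSemigroupProperties +-commutativeSemigroup using (interchange)
    open CommSemigroupProperties *-commutativeSemigroup using (x∙yz≈y∙xz)

    e-sym : ℕ → List ℕ → Carrier
    e-sym zero    _       = 1#
    e-sym (suc k) []      = 0#
    e-sym (suc k) (a ∷ L) = e-sym (suc k) L + e a * e-sym k L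

    e-sym-vanishes : ∀ L k → length L < k → e-sym k L ≈ 0#
    e-sym-vanishes []      (suc k) _         = refl
    e-sym-vanishes (a ∷ L) (suc k) (s≤s L<k) = begin
      e-sym (suc k) L + e a * e-sym k L ≈⟨ +-cong (e-sym-vanishes L (suc k) (ℕP.m<n⇒m<1+n L<k))
                                                   (*-congˡ (e-sym-vanishes L k L<k)) ⟩
      0# + e a * 0#                     ≈⟨ trans (+-identityˡ _) (zeroʳ _) ⟩
      0#                                ∎

    Σt : (ℕ → Carrier) → List ℕ → Carrier
    Σt g []      = g 0
    Σt g (a ∷ L) = Σt g L + e a * Σt (λ k → g (suc k)) L

    Σt-cong : ∀ L {g h} → (∀ k → g k ≈ h k) → Σt g L ≈ Σt h L
    Σt-cong []      g≈h = g≈h 0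
    Σt-cong (a ∷ L) g≈h = +-cong (Σt-cong L g≈h) (*-congˡ (Σt-cong L (λ k → g≈h (suc k))))

    Σt-+ : ∀ L g h → Σt (λ k → g k + h k) L ≈ Σt g L + Σt h L
    Σt-+ []      g h = refl
    Σt-+ (a ∷ L) g h = begin
      Σt (λ k → g k + h k) L + e a * Σt (λ k → g (suc k) + h (suc k)) L
        ≈⟨ +-cong (Σt-+ L g h) (trans (*-congˡ (Σt-+ L _ _)) (distribˡ _ _ _)) ⟩
      (Σt g L + Σt h L) + (e a * Σt (λ k → g (suc k)) L + e a * Σt (λ k → h (suc k)) L)
        ≈⟨ interchange _ _ _ _ ⟩
      Σt g (a ∷ L) + Σt h (a ∷ L) ∎

    Σt-*ˡ : ∀ L x g → Σt (λ k → x * g k) L ≈ x * Σt g L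
    Σt-*ˡ []      x g = refl
    Σt-*ˡ (a ∷ L) x g = begin
      Σt (λ k → x * g k) L + e a * Σt (λ k → x * g (suc k)) L
        ≈⟨ +-cong (Σt-*ˡ L x g) (trans (*-congˡ (Σt-*ˡ L x _)) (x∙yz≈y∙xz _ _ _)) ⟩
      x * Σt g L + x * (e a * Σt (λ k → g (suc k)) L)
        ≈⟨ distribˡ _ _ _ ⟨
      x * Σt g (a ∷ L) ∎

    Σt≈Σ< : ∀ L g N → length L < N → Σt g L ≈ Σ< N (λ k → g k * e-sym k L)
    Σt≈Σ< []      g (suc N) _         = sym (trans
      (+-cong (*-identityʳ (g 0)) (Σ<-zero N (λ k → zeroʳ (g (suc k))))) (+-identityʳ (g 0)))
    Σt≈Σ< (a ∷ L) g (suc N) (s≤s L<N) = begin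
      Σt g L + e a * Σt (λ k → g (suc k)) L
        ≈⟨ +-cong (Σt≈Σ< L g (suc N) (ℕP.m<n⇒m<1+n L<N)) (*-congˡ (Σt≈Σ< L _ N L<N)) ⟩
      (g 0 * 1# + Σ< N (λ k → g (suc k) * e-sym (suc k) L)) + e a * Σ< N (λ k → g (suc k) * e-sym k L)
        ≈⟨ +-assoc _ _ _ ⟩
      g 0 * 1# + (Σ< N (λ k → g (suc k) * e-sym (suc k) L) + e a * Σ< N (λ k → g (suc k) * e-sym k L))
        ≈⟨ +-congˡ (+-congˡ (Σ<-*ˡ N (e a) _)) ⟩
      g 0 * 1# + (Σ< N (λ k → g (suc k) * e-sym (suc k) L) + Σ< N (λ k → e a * (g (suc k) * e-sym k L)))
        ≈⟨ +-congˡ (Σ<-+ N _ _) ⟨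
      g 0 * 1# + Σ< N (λ k → g (suc k) * e-sym (suc k) L + e a * (g (suc k) * e-sym k L))
        ≈⟨ +-congˡ (Σ<-cong N (λ k → trans (+-congˡ (x∙yz≈y∙xz _ _ _)) (sym (distribˡ _ _ _)))) ⟩
      g 0 * 1# + Σ< N (λ k → g (suc k) * e-sym (suc k) (a ∷ L)) ∎

  module Recurrence (u : Carrier) where
    open CommSemigroupProperties +-commutativeSemigroup using (xy∙z≈yz∙x)
    open CommSemigroupProperties *-commutativeSemigroup using (x∙yz≈y∙xz; xy∙z≈xz∙y)

    w : ℕ → Carrier
    w zero          = - 1#
    w (suc zero)    = 1#
    w (suc (suc k)) = u * (w (suc k) + w k)

    w₂≈0 : w 2 ≈ 0#
    w₂≈0 = trans (*-congˡ (-‿inverseʳ 1#)) (zeroʳ u)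

    module _ (bin : ℕ → ℕ → Carrier)
             (bin-> : ∀ q j → q < j → bin q j ≈ 0#)
             (bin-0 : ∀ q → bin q 0 ≈ 1#)
             (bin-suc : ∀ q j → bin (suc q) (suc j) ≈ bin q j + bin q (suc j)) where

      diagonal : ℕ → Carrier
      diagonal m = Σ< (suc m) (λ q → bin q (m ∸ q) * u ^ suc q)

      u*diagonal : ∀ m → u * diagonal m ≈ Σ< (suc m) (λ q → bin q (m ∸ q) * u ^ (2 ℕ.+ q))
      u*diagonal m = trans (Σ<-*ˡ (suc m) u (λ q → bin q (m ∸ q) * u ^ suc q))
                           (Σ<-cong (suc m) (λ q → x∙yz≈y∙xz u (bin q (m ∸ q)) (u ^ suc q)))

      diagonal-rec : ∀ m → diagonal (2 ℕ.+ m) ≈ u * (diagonal (1 ℕ.+ m) + diagonal m)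
      diagonal-rec m = begin
        bin 0 (2 ℕ.+ m) * u ^ 1 + Σ< (suc (suc m)) H
          ≈⟨ +-cong (trans (*-congʳ (bin-> 0 (2 ℕ.+ m) (s≤s z≤n))) (zeroˡ _)) (Σ<-suc (suc m) H) ⟩
        0# + (Σ< (suc m) H + H (suc m))
          ≈⟨ +-identityˡ _ ⟩
        Σ< (suc m) H + H (suc m)
          ≈⟨ +-cong (trans (Σ<-cong-< (suc m) pascal) (Σ<-+ (suc m) A₀ A₁)) (last-term (2 ℕ.+ m)) ⟩
        (Σ< (suc m) A₀ + Σ< (suc m) A₁) + u ^ (3 ℕ.+ m)
          ≈⟨ xy∙z≈yz∙x _ _ _ ⟩
        (Σ< (suc m) A₁ + u ^ (3 ℕ.+ m)) + Σ< (suc m) A₀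
          ≈⟨ +-congʳ (+-congˡ (last-term (suc m))) ⟨
        (Σ< (suc m) A₁ + bin (suc m) (m ∸ m) * u ^ (3 ℕ.+ m)) + Σ< (suc m) A₀
          ≈⟨ +-cong (trans (u*diagonal (suc m)) (Σ<-suc (suc m) A₁)) (u*diagonal m) ⟨
        u * diagonal (1 ℕ.+ m) + u * diagonal m
          ≈⟨ distribˡ _ _ _ ⟨
        u * (diagonal (1 ℕ.+ m) + diagonal m) ∎
        where
        H A₀ A₁ : ℕ → Carrier
        H  q = bin (suc q) (suc m ∸ q) * u ^ (2 ℕ.+ q)
        A₀ q = bin q (m ∸ q) * u ^ (2 ℕ.+ q)
        A₁ q = bin q (suc m ∸ q) * u ^ (2 ℕ.+ q)
        last-term : ∀ q → bin q (m ∸ m) * u ^ (3 ℕ.+ m) ≈ u ^ (3 ℕ.+ m)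
        last-term q = trans (*-congʳ (trans (reflexive (≡.cong (bin q) (ℕP.n∸n≡0 m))) (bin-0 q)))
                            (*-identityˡ _)
        pascal : ∀ q → q < suc m → H q ≈ A₀ q + A₁ q
        pascal q (s≤s q≤m) = trans (*-congʳ (trans (reflexive (≡.cong (bin (suc q)) 1+m∸q≡1+[m∸q]))
          (trans (bin-suc q (m ∸ q)) (+-congˡ (reflexive (≡.cong (bin q) (≡.sym 1+m∸q≡1+[m∸q])))))))
          (distribʳ _ _ _)
          where
          1+m∸q≡1+[m∸q] : suc m ∸ q ≡ suc (m ∸ q)
          1+m∸q≡1+[m∸q] = ℕP.+-∸-assoc 1 q≤m

      diagonal₀ : diagonal 0 ≈ u ^ 1
      diagonal₀ = trans (+-identityʳ _) (trans (*-congʳ (bin-0 0)) (*-identityˡ _))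

      diagonal₁ : diagonal 1 ≈ u ^ 2
      diagonal₁ = trans (+-cong (trans (*-congʳ (bin-> 0 1 (s≤s z≤n))) (zeroˡ _))
                                (trans (+-identityʳ _) (trans (*-congʳ (bin-0 1)) (*-identityˡ _))))
                        (+-identityˡ _)

      w≈diagonal : ∀ m → w (3 ℕ.+ m) ≈ diagonal m × w (4 ℕ.+ m) ≈ diagonal (1 ℕ.+ m)
      w≈diagonal zero    = w₃≈ , w₄≈
        where
        w₃≈ : w 3 ≈ diagonal 0
        w₃≈ = trans (*-congˡ (trans (+-congʳ w₂≈0) (+-identityˡ 1#))) (sym diagonal₀)
        w₄≈ : w 4 ≈ diagonal 1
        w₄≈ = trans (*-congˡ (trans (+-cong w₃≈ w₂≈0) (trans (+-identityʳ _) diagonal₀))) (sym diagonal₁)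
      w≈diagonal (suc m) = proj₂ IH , trans (*-congˡ (+-cong (proj₂ IH) (proj₁ IH))) (sym (diagonal-rec m))
        where
        IH = w≈diagonal m

      Σ<-binomial : ∀ L (T : ℕ → Carrier) → (∀ i → L ≤ i → T i ≈ 0#) →
        Σ< L (λ q → Σ< (suc q) (λ j → bin q j * T (q ℕ.+ j) * u ^ suc q)) ≈ Σ< L (λ m → w (3 ℕ.+ m) * T m)
      Σ<-binomial L T T≈0 = begin
        Σ< L (λ q → Σ< (suc q) (F q))
          ≈⟨ Σ<-triangle L F
               (λ q j q<j → trans (*-congʳ (trans (*-congʳ (bin-> q j q<j)) (zeroˡ _))) (zeroˡ _))
               (λ q j L≤q+j → trans (*-congʳ (trans (*-congˡ (T≈0 (q ℕ.+ j) L≤q+j)) (zeroʳ _))) (zeroˡ _)) ⟩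
        Σ< L (λ m → Σ< (suc m) (λ q → F q (m ∸ q)))
          ≈⟨ Σ<-cong L (λ m → trans (Σ<-cong-< (suc m) (antidiagonal-term m))
                                    (sym (Σ<-*ʳ (suc m) (T m) (λ q → bin q (m ∸ q) * u ^ suc q)))) ⟩
        Σ< L (λ m → diagonal m * T m)
          ≈⟨ Σ<-cong L (λ m → *-congʳ (sym (proj₁ (w≈diagonal m)))) ⟩
        Σ< L (λ m → w (3 ℕ.+ m) * T m) ∎
        where
        F : ℕ → ℕ → Carrier
        F q j = bin q j * T (q ℕ.+ j) * u ^ suc q
        antidiagonal-term : ∀ m q → q < suc m → F q (m ∸ q) ≈ bin q (m ∸ q) * u ^ suc q * T m
        antidiagonal-term m q (s≤s q≤m) =
          trans (*-congʳ (*-congˡ (reflexive (≡.cong T (ℕP.m+[n∸m]≡n q≤m))))) (xy∙z≈xz∙y _ _ _)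

  module Core (u Y : Carrier) (u+1≈Y : u + 1# ≈ Y) (e : ℕ → Carrier) where
    open Symmetric e
    open Recurrence u using (w; w₂≈0)
    open CommSemigroupProperties +-commutativeSemigroup using (interchange; x∙yz≈z∙xy)
    open CommSemigroupProperties *-commutativeSemigroup using (x∙yz≈xy∙z)

    Y^ : Bool → Carrier
    Y^ true  = Y
    Y^ false = 1#

    ΣL : List ℕ → (ℕ → Carrier) → Carrier
    ΣL []      h = 0#
    ΣL (a ∷ L) h = h a + ΣL L h

    ΣL-cong : ∀ L {h h′} → (∀ a → h a ≈ h′ a) → ΣL L h ≈ ΣL L h′
    ΣL-cong []      h≈h′ = refl
    ΣL-cong (a ∷ L) h≈h′ = +-cong (h≈h′ a) (ΣL-cong L h≈h′)

    ΣL-cong-All : ∀ {L h h′} → All (λ a → h a ≈ h′ a) L → ΣL L h ≈ ΣL L h′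
    ΣL-cong-All []            = refl
    ΣL-cong-All (h≈h′ ∷ h≈h′s) = +-cong h≈h′ (ΣL-cong-All h≈h′s)

    ΣL-+ : ∀ L h h′ → ΣL L (λ a → h a + h′ a) ≈ ΣL L h + ΣL L h′
    ΣL-+ []      h h′ = sym (+-identityˡ 0#)
    ΣL-+ (a ∷ L) h h′ = trans (+-congˡ (ΣL-+ L h h′)) (interchange _ _ _ _)

    ΣL-*ʳ : ∀ L x h → ΣL L h * x ≈ ΣL L (λ a → h a * x)
    ΣL-*ʳ []      x h = zeroˡ x
    ΣL-*ʳ (a ∷ L) x h = trans (distribʳ x _ _) (+-congˡ (ΣL-*ʳ L x h))

    homogenise : ∀ L (M G′ P′ : ℕ → Carrier) (G W P : Carrier) →
      G ≈ 1# + ΣL L (λ a → M a * G′ a) → P + W ≈ ΣL L (λ a → M a * P′ a) →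
      G * W + P ≈ ΣL L (λ a → M a * (G′ a * W + P′ a))
    homogenise L M G′ P′ G W P G-rec P-rec = begin
      G * W + P
        ≈⟨ +-congʳ (trans (*-congʳ G-rec) (distribʳ W 1# _)) ⟩
      (1# * W + ΣL L (λ a → M a * G′ a) * W) + P
        ≈⟨ +-congʳ (+-cong (*-identityˡ W) (ΣL-*ʳ L W _)) ⟩
      (W + ΣL L (λ a → M a * G′ a * W)) + P
        ≈⟨ trans (+-congʳ (+-comm _ _)) (+-assoc _ _ _) ⟩
      ΣL L (λ a → M a * G′ a * W) + (W + P)
        ≈⟨ +-congˡ (trans (+-comm W P) P-rec) ⟩
      ΣL L (λ a → M a * G′ a * W) + ΣL L (λ a → M a * P′ a)
        ≈⟨ ΣL-+ L _ _ ⟨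
      ΣL L (λ a → M a * G′ a * W + M a * P′ a)
        ≈⟨ ΣL-cong L (λ a → trans (+-congʳ (*-assoc _ _ _)) (sym (distribˡ _ _ _))) ⟩
      ΣL L (λ a → M a * (G′ a * W + P′ a)) ∎

    f : Bool → ℕ → Carrier
    f false k = w (suc k)
    f true  k = w (suc (suc k)) + w (suc k)

    f-suc+w : ∀ ε k → f ε (suc k) + w (suc k) ≈ Y^ ε * f true k
    f-suc+w false k = sym (*-identityˡ _)
    f-suc+w true  k = begin
      (u * f true k + w (suc (suc k))) + w (suc k) ≈⟨ +-assoc _ _ _ ⟩
      u * f true k + f true k                      ≈⟨ +-congˡ (*-identityˡ _) ⟨
      u * f true k + 1# * f true k                 ≈⟨ distribʳ _ _ _ ⟨
      (u + 1#) * f true k                          ≈⟨ *-congʳ u+1≈Y ⟩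
      Y * f true k                                 ∎

    f0+w0 : ∀ ε → f ε 0 + w 0 ≈ 0#
    f0+w0 false = -‿inverseʳ 1#
    f0+w0 true  = begin
      (w 2 + 1#) + - 1# ≈⟨ +-congʳ (+-congʳ w₂≈0) ⟩
      (0# + 1#) + - 1#  ≈⟨ trans (+-congʳ (+-identityˡ 1#)) (-‿inverseʳ 1#) ⟩
      0#                ∎

    above : ℕ → List ℕ → List ℕ
    above b = filterᵇ (b <ᵇ_)

    above-all : ∀ {b A} → All (b <_) A → above b A ≡ A
    above-all b<A = filter-all (T? ∘ (_ <ᵇ_)) (All.map ℕP.<⇒<ᵇ b<A)

    above-reject : ∀ {a c A} → c ≤ a → above a (c ∷ A) ≡ above a A
    above-reject {a} {c} {A} c≤a =
      filter-reject (T? ∘ (a <ᵇ_)) {c} {A} (λ a<ᵇc → ℕP.≤⇒≯ c≤a (ℕP.<ᵇ⇒< a c a<ᵇc))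

    step : ℕ → Bool → ℕ → Carrier
    step b ε a = e a * Y^ ((b <ᵇ a) ∧ ε)

    head-step : ∀ c A → All (c <_) A → ∀ b ε →
      Σt (f ε) (above b (c ∷ A)) + Σt w (c ∷ A) ≈
      step b ε c * Σt (f (b <ᵇ c)) A + (Σt (f ε) (above b A) + Σt w A)
    head-step c A c<A b ε with b <ᵇ c in b<ᵇc
    ... | false = begin
      Σt (f ε) (above b A) + (Σt w A + e c * Σt (f false) A)
        ≈⟨ x∙yz≈z∙xy _ _ _ ⟩
      e c * Σt (f false) A + (Σt (f ε) (above b A) + Σt w A)
        ≈⟨ +-congʳ (*-congʳ (*-identityʳ (e c))) ⟨
      e c * 1# * Σt (f false) A + (Σt (f ε) (above b A) + Σt w A) ∎
    ... | true rewrite above-all (All.map (ℕP.<-trans (ℕP.<ᵇ⇒< b c (≡.subst T (≡.sym b<ᵇc) _))) c<A) = begin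
      (Σt (f ε) A + e c * Σt (λ k → f ε (suc k)) A) + (Σt w A + e c * Σt (λ k → w (suc k)) A)
        ≈⟨ trans (interchange _ _ _ _) (+-comm _ _) ⟩
      (e c * Σt (λ k → f ε (suc k)) A + e c * Σt (λ k → w (suc k)) A) + (Σt (f ε) A + Σt w A)
        ≈⟨ +-congʳ (trans (sym (distribˡ _ _ _)) (*-congˡ (sym (Σt-+ A _ _)))) ⟩
      e c * Σt (λ k → f ε (suc k) + w (suc k)) A + (Σt (f ε) A + Σt w A)
        ≈⟨ +-congʳ (*-congˡ (trans (Σt-cong A (f-suc+w ε)) (Σt-*ˡ A (Y^ ε) (f true)))) ⟩
      e c * (Y^ ε * Σt (f true) A) + (Σt (f ε) A + Σt w A)
        ≈⟨ +-congʳ (x∙yz≈xy∙z _ _ _) ⟩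
      e c * Y^ ε * Σt (f true) A + (Σt (f ε) A + Σt w A) ∎

    numerator-rec : ∀ A → AllPairs _<_ A → ∀ b ε →
      Σt (f ε) (above b A) + Σt w A ≈ ΣL A (λ a → step b ε a * Σt (f (b <ᵇ a)) (above a A))
    numerator-rec []      _   b ε = f0+w0 ε
    numerator-rec (c ∷ A) (c<A ∷ A↑) b ε = begin
      Σt (f ε) (above b (c ∷ A)) + Σt w (c ∷ A)
        ≈⟨ head-step c A c<A b ε ⟩
      step b ε c * Σt (f (b <ᵇ c)) A + (Σt (f ε) (above b A) + Σt w A)
        ≈⟨ +-cong (*-congˡ (reflexive (≡.cong (Σt (f (b <ᵇ c))) (≡.sym c-above-c))))
                  (trans (numerator-rec A A↑ b ε) (ΣL-cong-All (All.map tail-term c<A))) ⟩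
      ΣL (c ∷ A) (λ a → step b ε a * Σt (f (b <ᵇ a)) (above a (c ∷ A))) ∎
      where
      c-above-c : above c (c ∷ A) ≡ A
      c-above-c = ≡.trans (above-reject {c} {c} {A} ℕP.≤-refl) (above-all c<A)
      tail-term : ∀ {a} → c < a →
        step b ε a * Σt (f (b <ᵇ a)) (above a A) ≈ step b ε a * Σt (f (b <ᵇ a)) (above a (c ∷ A))
      tail-term {a} c<a =
        *-congˡ (reflexive (≡.cong (Σt _) (≡.sym (above-reject {a} {c} {A} (ℕP.<⇒≤ c<a)))))

  module Formula (u : Carrier) (e : ℕ → Carrier)
                  (bin : ℕ → ℕ → Carrier)
                  (bin-> : ∀ q j → q < j → bin q j ≈ 0#)
                  (bin-0 : ∀ q → bin q 0 ≈ 1#)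
                  (bin-suc : ∀ q j → bin (suc q) (suc j) ≈ bin q j + bin q (suc j)) where
    open Symmetric e
    open Recurrence u
    open import Algebra.Properties.Ring ring using (-‿+-comm; -‿involutive)

    w₂-term+ : ∀ x S → w 2 * x + S ≈ S
    w₂-term+ x S = trans (+-congʳ (trans (*-congʳ w₂≈0) (zeroˡ x))) (+-identityˡ S)

    e-sym-vanishes-beyond : ∀ A s {i} → suc (length A) ∸ s ≤ i → e-sym (s ℕ.+ i) A ≈ 0#
    e-sym-vanishes-beyond A s {i} le =
      e-sym-vanishes A (s ℕ.+ i) (ℕP.≤-trans (ℕP.m≤n+m∸n (suc (length A)) s) (ℕP.+-monoʳ-≤ s le))

    tail-sum : ∀ A s → Σ< (suc (length A) ∸ s) (λ q → Σ< (suc q) (λ j →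
                          bin q j * e-sym (s ℕ.+ (q ℕ.+ j)) A * u ^ suc q))
                     ≈ Σ< (suc (length A) ∸ s) (λ m → w (3 ℕ.+ m) * e-sym (s ℕ.+ m) A)
    tail-sum A s = Σ<-binomial bin bin-> bin-0 bin-suc (suc (length A) ∸ s) (λ i → e-sym (s ℕ.+ i) A)
                     (λ i → e-sym-vanishes-beyond A s)

    numerator : ∀ A →
      1# + Σ< (suc (length A) ∸ 2) (λ q → Σ< (suc q) (λ j →
             bin q j * e-sym (2 ℕ.+ (q ℕ.+ j)) A * u ^ suc q))
        ≈ Σt (λ k → w (suc k)) A
    numerator A = begin
      1# + Σ< L (λ q → Σ< (suc q) (λ j → bin q j * e-sym (2 ℕ.+ (q ℕ.+ j)) A * u ^ suc q))
        ≈⟨ +-congˡ (tail-sum A 2) ⟩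
      1# + Σ< L (λ m → w (3 ℕ.+ m) * e-sym (2 ℕ.+ m) A)
        ≈⟨ +-cong (sym (*-identityˡ 1#)) (sym (w₂-term+ _ _)) ⟩
      w 1 * e-sym 0 A + (w 2 * e-sym 1 A + Σ< L (λ m → w (3 ℕ.+ m) * e-sym (2 ℕ.+ m) A))
        ≈⟨ Σt≈Σ< A (λ k → w (suc k)) (2 ℕ.+ L) (ℕP.m≤n+m∸n (suc (length A)) 2) ⟨
      Σt (λ k → w (suc k)) A ∎
      where
      L = suc (length A) ∸ 2

    denominator : ∀ A →
      (1# + - e-sym 1 A) + - Σ< (suc (length A) ∸ 3) (λ q → Σ< (suc q) (λ j →
                               bin q j * e-sym (3 ℕ.+ (q ℕ.+ j)) A * u ^ suc q))
        ≈ - Σt w A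
    denominator A = begin
      (1# + - e-sym 1 A) + - Σ< L (λ q → Σ< (suc q) (λ j → bin q j * e-sym (3 ℕ.+ (q ℕ.+ j)) A * u ^ suc q))
        ≈⟨ +-congˡ (-‿cong (tail-sum A 3)) ⟩
      (1# + - e-sym 1 A) + - S
        ≈⟨ +-assoc _ _ _ ⟩
      1# + (- e-sym 1 A + - S)
        ≈⟨ +-cong (sym (-‿involutive 1#)) (-‿+-comm _ _) ⟩
      - - 1# + - (e-sym 1 A + S)
        ≈⟨ -‿+-comm _ _ ⟩
      - (- 1# + (e-sym 1 A + S))
        ≈⟨ -‿cong (+-cong (sym (*-identityʳ (- 1#)))
                   (+-cong (sym (*-identityˡ _)) (sym (w₂-term+ _ S)))) ⟩
      - (w 0 * e-sym 0 A + (w 1 * e-sym 1 A + (w 2 * e-sym 2 A + S)))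
        ≈⟨ -‿cong (Σt≈Σ< A w (3 ℕ.+ L) (ℕP.m≤n+m∸n (suc (length A)) 3)) ⟨
      - Σt w A ∎
      where
      L = suc (length A) ∸ 3
      S = Σ< L (λ m → w (3 ℕ.+ m) * e-sym (3 ℕ.+ m) A)

open SeriesRing using (seriesRing)
open CommutativeRing seriesRing
  using (setoid; refl; sym; trans; +-cong; +-congˡ; +-assoc; +-identityʳ; -‿cong;
         *-cong; *-congˡ; *-congʳ; *-identityˡ; *-comm; *-commutativeSemigroup; zeroʳ; distribˡ; ring)
open Sums seriesRing using (Σ<; Σ<-cong)
open RawSemiringDefinitions (Semiring.rawSemiring (CommutativeRing.semiring seriesRing)) using (_^_)
open import Algebra.Properties.Ring ring using (-‿distribʳ-*; -‿involutive; +-inverseˡ-unique)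

binS-> : ∀ q j → q < j → binS q j ≈S 𝟘
binS-> q j q<j rewrite k>n⇒nCk≡0 q<j = λ _ _ _ → ≡.refl

binS-0 : ∀ q → binS q 0 ≈S 𝟙
binS-0 q _ _ _ = ≡.refl

cst-+ : ∀ a b → cst (+ (a ℕ.+ b)) ≈S cst (+ a) ⊕ cst (+ b)
cst-+ a b zero    zero    zero    = ℤP.pos-+ a b
cst-+ a b zero    zero    (suc m) = ≡.refl
cst-+ a b zero    (suc r) m       = ≡.refl
cst-+ a b (suc n) r       m       = ≡.refl

binS-suc : ∀ q j → binS (suc q) (suc j) ≈S binS q j ⊕ binS q (suc j)
binS-suc q j rewrite ≡.sym (nCk+nC[k+1]≡[n+1]C[k+1] q j) = cst-+ (q C j) (q C suc j)

-1+1≈0 : cst -[1+ 0 ] ⊕ 𝟙 ≈S 𝟘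
-1+1≈0 zero    zero    zero    = ≡.refl
-1+1≈0 zero    zero    (suc m) = ≡.refl
-1+1≈0 zero    (suc r) m       = ≡.refl
-1+1≈0 (suc n) r       m       = ≡.refl

y-1+1≈Y : y-1 ⊕ 𝟙 ≈S Y
y-1+1≈Y = trans (+-assoc Y (cst -[1+ 0 ]) 𝟙) (trans (+-congˡ {Y} -1+1≈0) (+-identityʳ Y))

weight : ℕ → Series
weight a = X ^S a ⊗ Z

open Symmetric seriesRing weight using (e-sym; Σt)
open Recurrence seriesRing y-1 using (w)
open Core seriesRing y-1 Y y-1+1≈Y weight
  using (Y^; ΣL; f; above; above-all; step; homogenise; numerator-rec)
open Formula seriesRing y-1 weight binS binS-> binS-0 binS-suc using (numerator; denominator)

t≈e-sym : ∀ k L → t k L ≈S e-sym k L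
t≈e-sym zero    L       = *-identityˡ 𝟙
t≈e-sym (suc k) []      = zeroʳ (Z ^S suc k)
t≈e-sym (suc k) (a ∷ L) = begin
  Z ^S suc k ⊗ (esym (suc k) L ⊕ X ^S a ⊗ esym k L)
    ≈⟨ distribˡ (Z ^S suc k) (esym (suc k) L) (X ^S a ⊗ esym k L) ⟩
  t (suc k) L ⊕ (Z ⊗ Z ^S k) ⊗ (X ^S a ⊗ esym k L)
    ≈⟨ +-cong (t≈e-sym (suc k) L) (interchange Z (Z ^S k) (X ^S a) (esym k L)) ⟩
  e-sym (suc k) L ⊕ (Z ⊗ X ^S a) ⊗ (Z ^S k ⊗ esym k L)
    ≈⟨ +-congˡ {e-sym (suc k) L} (*-cong (*-comm Z (X ^S a)) (t≈e-sym k L)) ⟩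
  e-sym (suc k) (a ∷ L) ∎
  where
  open ≈-Reasoning setoid
  open CommSemigroupProperties *-commutativeSemigroup using (interchange)

^S≈^ : ∀ F k → F ^S k ≈S F ^ k
^S≈^ F zero    = refl
^S≈^ F (suc k) = *-congˡ {F} (^S≈^ F k)

ΣS-applyUpTo : ∀ n (g h : ℕ → ℕ) F → ΣS (map g (applyUpTo h n)) F ≈S Σ< n (λ q → F (g (h q)))
ΣS-applyUpTo zero    g h F = refl
ΣS-applyUpTo (suc n) g h F = +-congˡ {F (g (h 0))} (ΣS-applyUpTo n g (λ i → h (suc i)) F)

ΣS-range : ∀ lo hi F → ΣS (range lo hi) F ≈S Σ< (suc hi ∸ lo) (λ q → F (lo ℕ.+ q))
ΣS-range lo hi F = ΣS-applyUpTo (suc hi ∸ lo) (lo ℕ.+_) (λ i → i) F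

binomial-sum≈ : ∀ A s L →
  Σ< L (λ q → ΣS (range 0 q) (λ j → binS q j ⊗ t (s ℕ.+ q ℕ.+ j) A ⊗ (y-1 ^S suc q)))
    ≈S Σ< L (λ q → Σ< (suc q) (λ j → binS q j ⊗ e-sym (s ℕ.+ q ℕ.+ j) A ⊗ y-1 ^ suc q))
binomial-sum≈ A s L = Σ<-cong L (λ q → trans (ΣS-range 0 q (term q)) (Σ<-cong (suc q) (λ j →
  *-cong (*-congˡ {binS q j} (t≈e-sym (s ℕ.+ q ℕ.+ j) A)) (^S≈^ y-1 (suc q)))))
  where
  term : ℕ → ℕ → Series
  term q j = binS q j ⊗ t (s ℕ.+ q ℕ.+ j) A ⊗ (y-1 ^S suc q)

Num≈ : ∀ A → Num A ≈S Σt (λ k → w (suc k)) A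
Num≈ A = trans (+-congˡ {𝟙} (trans (ΣS-range 2 (length A) F) (binomial-sum≈ A 2 (suc (length A) ∸ 2))))
               (numerator A)
  where
  F : ℕ → Series
  F p = ΣS (range 0 (p ∸ 2)) λ j → binS (p ∸ 2) j ⊗ t (p ℕ.+ j) A ⊗ (y-1 ^S (p ∸ 1))

Den≈ : ∀ A → Den A ≈S ⊖ Σt w A
Den≈ A = trans (+-cong (+-congˡ {𝟙} (-‿cong {t 1 A} (t≈e-sym 1 A)))
                       (-‿cong {ΣS (range 3 (length A)) F}
                         (trans (ΣS-range 3 (length A) F) (binomial-sum≈ A 3 (suc (length A) ∸ 3)))))
               (denominator A)
  where
  F : ℕ → Series
  F p = ΣS (range 0 (p ∸ 3)) λ j → binS (p ∸ 3) j ⊗ t (p ℕ.+ j) A ⊗ (y-1 ^S (p ∸ 2))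

ΣS-cong : ∀ L {F G : ℕ → Series} → (∀ a → F a ≈S G a) → ΣS L F ≈S ΣS L G
ΣS-cong []      F≈G = refl
ΣS-cong (a ∷ L) F≈G = +-cong (F≈G a) (ΣS-cong L F≈G)

ΣL≈ΣS : ∀ L (F : ℕ → Series) → ΣL L F ≈S ΣS L F
ΣL≈ΣS []      F = refl
ΣL≈ΣS (a ∷ L) F = +-congˡ {F a} (ΣL≈ΣS L F)

Y^≈mon : ∀ p → Y^ p ≈S mon 0 ⟦ p ⟧ 0
Y^≈mon true  = Y≈mon
Y^≈mon false = 𝟙≈mon

module _ (A : List ℕ) (A↑ : AllPairs _<_ A) where
  open Compositions A using (C; D≈C; C-rec; ascent)

  W : Series
  W = Σt w A

  P : ℕ → Bool → Series
  P b ε = Σt (f ε) (above b A)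

  K : ℕ × Bool → Series
  K (b , ε) = C b ε ⊗ W ⊕ P b ε

  step≈mon : ∀ b ε a → step b ε a ≈S mon a (ascent b ε a) 1
  step≈mon b ε a = weight≈mon a ((b <ᵇ a) ∧ ε) (Y^≈mon ((b <ᵇ a) ∧ ε))

  K-rec : ∀ i → K i ≈S ΣS A (λ a → mon a (ascent (proj₁ i) (proj₂ i) a) 1 ⊗ K (a , (proj₁ i <ᵇ a)))
  K-rec (b , ε) =
    trans (homogenise A (step b ε) (λ a → C a (b <ᵇ a)) (λ a → P a (b <ᵇ a)) (C b ε) W (P b ε)
                      C-rec′ (numerator-rec A A↑ b ε))
          (trans (ΣL≈ΣS A _) (ΣS-cong A (λ a → *-congʳ {K (a , (b <ᵇ a))} (step≈mon b ε a))))
    where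
    C-rec′ : C b ε ≈S 𝟙 ⊕ ΣL A (λ a → step b ε a ⊗ C a (b <ᵇ a))
    C-rec′ = trans (C-rec b ε) (+-congˡ {𝟙} (trans
      (ΣS-cong A (λ a → *-congʳ {C a (b <ᵇ a)} (sym (step≈mon b ε a)))) (sym (ΣL≈ΣS A _))))

  CW+P≈0 : C 0 false ⊗ W ⊕ P 0 false ≈S 𝟘
  CW+P≈0 = homogeneous-solution≈𝟘 A K (λ i → ascent (proj₁ i) (proj₂ i)) (λ i a → a , (proj₁ i <ᵇ a)) K-rec
             (0 , false)

  D⊗Den≈Num : All (0 <_) A → D A ⊗ Den A ≈S Num A
  D⊗Den≈Num 0<A = begin
    D A ⊗ Den A               ≈⟨ *-cong D≈C (Den≈ A) ⟩
    C 0 false ⊗ ⊖ W           ≈⟨ -‿distribʳ-* (C 0 false) W ⟨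
    ⊖ (C 0 false ⊗ W)         ≈⟨ -‿cong (+-inverseˡ-unique _ _ CW+P≈0) ⟩
    ⊖ ⊖ P 0 false             ≈⟨ -‿involutive (P 0 false) ⟩
    P 0 false                 ≡⟨ ≡.cong (Σt (f false)) (above-all 0<A) ⟩
    Σt (λ k → w (suc k)) A   ≈⟨ Num≈ A ⟨
    Num A                     ∎
    where open ≈-Reasoning setoid

lemma1 : (A : List ℕ) → Linked _<_ A → All (λ a → 0 < a) A →
    D A ⊗ Den A ≈S Num A
lemma1 A A↑ 0<A = D⊗Den≈Num A (Linked⇒AllPairs ℕP.<-trans A↑) 0<A
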